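{- Let $G\in\mathcal E$. Suppose a Left option $A$ of $G$ has a Right option $E$ which is a Left-end (i.e. $E=\{\;\mid E^{\mathcal R}\}$) with $E\leq_{\mathcal E}G$. Then $$G\equiv_{\mathcal E}\{\{\;\mid E\},\,G^{\mathcal L}\setminus\{A\}\mid G^{\mathcal R}\}.$$
   Context: All games are short two-player partizan games between Left and Right, identified with their game trees: $G=\{G^{\mathcal L}\mid G^{\mathcal R}\}$ with finite sets of options. Followers of $G$: $G$, its options, their options, etc. Disjunctive sum: $G+H=\{G^{\mathcal L}+H,G+H^{\mathcal L}\mid G^{\mathcal R}+H,G+H^{\mathcal R}\}$. Misère play: a player with no move on their turn wins. $o_L(G)=\mathrm L$ if $G^{\mathcal L}=\emptyset$, else $\max_{G^L}o_R(G^L)$; $o_R(G)=\mathrm R$ if $G^{\mathcal R}=\emptyset$, else $\min_{G^R}o_L(G^R)$; $\mathrm L>\mathrm R$; $o(G)=(o_L(G),o_R(G))$ ordered componentwise. A Left-end has no Left option; a dead Left-end has only Left-ends as followers; similarly Right. A game is dead-ending if each follower that is a Left-end (Right-end) is a dead Left-end (dead Right-end); $\mathcal E$ is the class of dead-ending games. $G\geq_{\mathcal E}H$ means $o(G+X)\geq o(H+X)$ for all $X\in\mathcal E$; $\equiv_{\mathcal E}$ means both directions. $\{\;\mid E\}$ denotes the game with no Left option and sole Right option $E$. -}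

module Defs where

open import Data.List using (List; []; _∷_; _++_; filter)
open import Data.List.Membership.Propositional using (_∈_)
open import Data.Product using (_×_; _,_)
open import Relation.Binary.PropositionalEquality using (_≡_; refl; cong; cong₂)
open import Relation.Nullary using (Dec; yes; no; ¬_; ¬?)

-- Short partizan games as finite game trees  { G^L | G^R }.
-- Option sets are represented by lists (duplicates are irrelevant for
-- everything defined below).
data Game : Set where
  ⟨_∣_⟩ : List Game → List Game → Game

leftOpts : Game → List Game
leftOpts ⟨ l ∣ r ⟩ = l

rightOpts : Game → List Game
rightOpts ⟨ l ∣ r ⟩ = r

mutual
  _≟_ : (G H : Game) → Dec (G ≡ H)
  ⟨ l ∣ r ⟩ ≟ ⟨ l' ∣ r' ⟩ with l ≟ˡ l' | r ≟ˡ r'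
  ... | yes refl | yes refl = yes refl
  ... | no ne    | _        = no λ { refl → ne refl }
  ... | yes _    | no ne    = no λ { refl → ne refl }

  _≟ˡ_ : (xs ys : List Game) → Dec (xs ≡ ys)
  [] ≟ˡ [] = yes refl
  [] ≟ˡ (y ∷ ys) = no λ ()
  (x ∷ xs) ≟ˡ [] = no λ ()
  (x ∷ xs) ≟ˡ (y ∷ ys) with x ≟ y | xs ≟ˡ ys
  ... | yes refl | yes refl = yes refl
  ... | no ne    | _        = no λ { refl → ne refl }
  ... | yes _    | no ne    = no λ { refl → ne refl }

-- Set difference  Xs ∖ {A}  (removes every copy of A)
_∖_ : List Game → Game → List Game
xs ∖ a = filter (λ x → ¬? (x ≟ a)) xs

mutual
  _+_ : Game → Game → Game
  ⟨ gl ∣ gr ⟩ + ⟨ hl ∣ hr ⟩ =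
    ⟨ sumL gl ⟨ hl ∣ hr ⟩ ++ sumR ⟨ gl ∣ gr ⟩ hl
    ∣ sumL gr ⟨ hl ∣ hr ⟩ ++ sumR ⟨ gl ∣ gr ⟩ hr ⟩

  sumL : List Game → Game → List Game
  sumL [] H = []
  sumL (g ∷ gs) H = (g + H) ∷ sumL gs H

  sumR : Game → List Game → List Game
  sumR G [] = []
  sumR ⟨ gl ∣ gr ⟩ (h ∷ hs) = (⟨ gl ∣ gr ⟩ + h) ∷ sumR ⟨ gl ∣ gr ⟩ hs

data Res : Set where
  L R : Res

data _≤ᴿ_ : Res → Res → Set where
  R≤ : ∀ {x} → R ≤ᴿ x
  L≤L : L ≤ᴿ L

maxᴿ : Res → Res → Res
maxᴿ L _ = L
maxᴿ R y = y

minᴿ : Res → Res → Res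
minᴿ R _ = R
minᴿ L y = y

mutual
  -- Left moves first; a player with no move wins (misère)
  oL : Game → Res
  oL ⟨ [] ∣ r ⟩ = L
  oL ⟨ g ∷ gs ∣ r ⟩ = maxOR g gs

  oR : Game → Res
  oR ⟨ l ∣ [] ⟩ = R
  oR ⟨ l ∣ g ∷ gs ⟩ = minOL g gs

  maxOR : Game → List Game → Res
  maxOR g [] = oR g
  maxOR g (h ∷ hs) = maxᴿ (oR g) (maxOR h hs)

  minOL : Game → List Game → Res
  minOL g [] = oL g
  minOL g (h ∷ hs) = minᴿ (oL g) (minOL h hs)

_≤ᵒ_ : Game → Game → Set
G ≤ᵒ H = (oL G ≤ᴿ oL H) × (oR G ≤ᴿ oR H)

data Follower : Game → Game → Set where
  self  : ∀ {G} → Follower G G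
  viaL  : ∀ {F G G'} → G' ∈ leftOpts G → Follower F G' → Follower F G
  viaR  : ∀ {F G G'} → G' ∈ rightOpts G → Follower F G' → Follower F G

LeftEnd : Game → Set
LeftEnd G = leftOpts G ≡ []

RightEnd : Game → Set
RightEnd G = rightOpts G ≡ []

DeadLeftEnd : Game → Set
DeadLeftEnd G = ∀ F → Follower F G → LeftEnd F

DeadRightEnd : Game → Set
DeadRightEnd G = ∀ F → Follower F G → RightEnd F

DeadEnding : Game → Set
DeadEnding G = ∀ F → Follower F G →
  (LeftEnd F → DeadLeftEnd F) × (RightEnd F → DeadRightEnd F)

_≥ℰ_ : Game → Game → Set
G ≥ℰ H = ∀ X → DeadEnding X → (H + X) ≤ᵒ (G + X)

_≤ℰ_ : Game → Game → Set
G ≤ℰ H = H ≥ℰ G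

_≡ℰ_ : Game → Game → Set
G ≡ℰ H = (G ≥ℰ H) × (H ≥ℰ G)

module Submission where

-- We prove the stronger
-- statement that o(G + X) = o(H + X) for every dead-ending X, by induction
-- on X.
--
-- The Right outcomes of G + X and H + X
-- agree because G and H have the same Right options.  For the Left
-- outcomes, a winning Left move to A + X is replaced by A′ + X (using
-- that E + X is then a Left win, and, when E + X is a Left-end, that X is
-- a dead Left-end), while a winning move to A′ + X is mirrored in G + X
-- through E ≤_𝓔 G.

open import Defs
open import Data.List using (List; []; _∷_; _++_; map)
open import Data.List.Membership.Propositional using (_∈_)
open import Data.List.Membership.Propositional.Properties
  using (∉[]; ∈-map⁺; ∈-map⁻; ∈-++⁺ˡ; ∈-++⁺ʳ; ∈-++⁻; ∈-filter⁺; ∈-filter⁻)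
open import Data.List.Relation.Unary.Any using (here; there)
open import Data.List.Properties using (++-conicalˡ; ++-conicalʳ)
open import Data.Product using (_×_; _,_; proj₁; proj₂; ∃-syntax)
open import Data.Sum using (_⊎_; inj₁; inj₂)
open import Data.Empty using (⊥-elim)
open import Relation.Binary.PropositionalEquality
  using (_≡_; _≢_; refl; sym; trans; cong₂; subst)
open import Relation.Nullary using (yes; no; ¬?)

-- Results are two-valued, so two results are equal as soon as each takes
-- a given value x exactly when the other does.
res-ext : ∀ (x a b : Res) → (a ≡ x → b ≡ x) → (b ≡ x → a ≡ x) → a ≡ b
res-ext _ L L _ _ = refl
res-ext _ R R _ _ = refl
res-ext L L R to _ = sym (to refl)
res-ext R L R _ from = from refl
res-ext L R L _ from = from refl
res-ext R R L to _ = sym (to refl)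

L≢R : L ≢ R
L≢R ()

L-upward : ∀ {a b} → a ≡ L → a ≤ᴿ b → b ≡ L
L-upward refl L≤L = refl

≡⇒≤ᴿ : ∀ {a b} → a ≡ b → a ≤ᴿ b
≡⇒≤ᴿ {L} refl = L≤L
≡⇒≤ᴿ {R} refl = R≤

maxOR-L⁺ : ∀ {h} g gs → h ∈ g ∷ gs → oR h ≡ L → maxOR g gs ≡ L
maxOR-L⁺ g [] (here refl) p = p
maxOR-L⁺ g (_ ∷ _) (here refl) p rewrite p = refl
maxOR-L⁺ g (h ∷ hs) (there m) p with oR g
... | L = refl
... | R = maxOR-L⁺ h hs m p

maxOR-L⁻ : ∀ g gs → maxOR g gs ≡ L → ∃[ h ] h ∈ g ∷ gs × oR h ≡ L
maxOR-L⁻ g [] p = g , here refl , p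
maxOR-L⁻ g (h ∷ hs) p with oR g in eq
... | L = g , here refl , eq
... | R with maxOR-L⁻ h hs p
...   | k , k∈ , q = k , there k∈ , q

minOL-R⁺ : ∀ {h} g gs → h ∈ g ∷ gs → oL h ≡ R → minOL g gs ≡ R
minOL-R⁺ g [] (here refl) p = p
minOL-R⁺ g (_ ∷ _) (here refl) p rewrite p = refl
minOL-R⁺ g (h ∷ hs) (there m) p with oL g
... | R = refl
... | L = minOL-R⁺ h hs m p

minOL-R⁻ : ∀ g gs → minOL g gs ≡ R → ∃[ h ] h ∈ g ∷ gs × oL h ≡ R
minOL-R⁻ g [] p = g , here refl , p
minOL-R⁻ g (h ∷ hs) p with oL g in eq
... | R = g , here refl , eq
... | L with minOL-R⁻ h hs p
...   | k , k∈ , q = k , there k∈ , q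

oL-end : ∀ Y → LeftEnd Y → oL Y ≡ L
oL-end ⟨ [] ∣ _ ⟩ refl = refl

oL-move : ∀ {Y′} Y → Y′ ∈ leftOpts Y → oR Y′ ≡ L → oL Y ≡ L
oL-move ⟨ g ∷ gs ∣ _ ⟩ m p = maxOR-L⁺ g gs m p

oL-L⁻ : ∀ Y → oL Y ≡ L → LeftEnd Y ⊎ (∃[ Y′ ] Y′ ∈ leftOpts Y × oR Y′ ≡ L)
oL-L⁻ ⟨ [] ∣ _ ⟩ _ = inj₁ refl
oL-L⁻ ⟨ g ∷ gs ∣ _ ⟩ p = inj₂ (maxOR-L⁻ g gs p)

oR-end : ∀ Y → RightEnd Y → oR Y ≡ R
oR-end ⟨ _ ∣ [] ⟩ refl = refl

oR-move : ∀ {Y′} Y → Y′ ∈ rightOpts Y → oL Y′ ≡ R → oR Y ≡ R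
oR-move ⟨ _ ∣ g ∷ gs ⟩ m p = minOL-R⁺ g gs m p

oR-R⁻ : ∀ Y → oR Y ≡ R → RightEnd Y ⊎ (∃[ Y′ ] Y′ ∈ rightOpts Y × oL Y′ ≡ R)
oR-R⁻ ⟨ _ ∣ [] ⟩ _ = inj₁ refl
oR-R⁻ ⟨ _ ∣ g ∷ gs ⟩ p = inj₂ (minOL-R⁻ g gs p)

oR-L-after : ∀ {Y′} Y → Y′ ∈ rightOpts Y → oR Y ≡ L → oL Y′ ≡ L
oR-L-after {Y′} Y m p with oL Y′ in eq
... | L = refl
... | R = ⊥-elim (L≢R (trans (sym p) (oR-move Y m eq)))

oR-L⁺ : ∀ {Y′} Y → Y′ ∈ rightOpts Y → (∀ {Z} → Z ∈ rightOpts Y → oL Z ≡ L) → oR Y ≡ L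
oR-L⁺ Y m all with oR Y in eq
... | L = refl
... | R with oR-R⁻ Y eq
...   | inj₁ end = ⊥-elim (∉[] (subst (_ ∈_) end m))
...   | inj₂ (Z , Z∈ , q) = ⊥-elim (L≢R (trans (sym (all Z∈)) q))

data Side : Set where
  left right : Side

opts : Side → Game → List Game
opts left  = leftOpts
opts right = rightOpts

sumL-map : ∀ gs X → sumL gs X ≡ map (_+ X) gs
sumL-map []       X = refl
sumL-map (g ∷ gs) X = cong₂ _∷_ refl (sumL-map gs X)

sumR-map : ∀ G xs → sumR G xs ≡ map (G +_) xs
sumR-map G           []       = refl
sumR-map ⟨ gl ∣ gr ⟩ (x ∷ xs) = cong₂ _∷_ refl (sumR-map ⟨ gl ∣ gr ⟩ xs)

opts-+ : ∀ s G X → opts s (G + X) ≡ map (_+ X) (opts s G) ++ map (G +_) (opts s X)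
opts-+ left  ⟨ gl ∣ gr ⟩ ⟨ xl ∣ xr ⟩ = cong₂ _++_ (sumL-map gl _) (sumR-map _ xl)
opts-+ right ⟨ gl ∣ gr ⟩ ⟨ xl ∣ xr ⟩ = cong₂ _++_ (sumL-map gr _) (sumR-map _ xr)

move-+ˡ : ∀ s {g} G X → g ∈ opts s G → g + X ∈ opts s (G + X)
move-+ˡ s G X m = subst (_ ∈_) (sym (opts-+ s G X)) (∈-++⁺ˡ (∈-map⁺ (_+ X) m))

move-+ʳ : ∀ s G {x} X → x ∈ opts s X → G + x ∈ opts s (G + X)
move-+ʳ s G X m =
  subst (_ ∈_) (sym (opts-+ s G X)) (∈-++⁺ʳ (map (_+ X) (opts s G)) (∈-map⁺ (G +_) m))

move-+⁻ : ∀ s G X {Y} → Y ∈ opts s (G + X) →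
  (∃[ g ] g ∈ opts s G × Y ≡ g + X) ⊎ (∃[ x ] x ∈ opts s X × Y ≡ G + x)
move-+⁻ s G X m with ∈-++⁻ (map (_+ X) (opts s G)) (subst (_ ∈_) (opts-+ s G X) m)
... | inj₁ mG = inj₁ (∈-map⁻ (_+ X) mG)
... | inj₂ mX = inj₂ (∈-map⁻ (G +_) mX)

map-≡[] : ∀ {f : Game → Game} xs → map f xs ≡ [] → xs ≡ []
map-≡[] [] _ = refl

end-+⁻ : ∀ s G X → opts s (G + X) ≡ [] → opts s G ≡ [] × opts s X ≡ []
end-+⁻ s G X e =
    map-≡[] (opts s G) (++-conicalˡ (map (_+ X) (opts s G)) _ e′)
  , map-≡[] (opts s X) (++-conicalʳ (map (_+ X) (opts s G)) _ e′)
  where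
  e′ : map (_+ X) (opts s G) ++ map (G +_) (opts s X) ≡ []
  e′ = trans (sym (opts-+ s G X)) e

end-+⁺ : ∀ s G X → opts s G ≡ [] → opts s X ≡ [] → opts s (G + X) ≡ []
end-+⁺ s G X eG eX rewrite opts-+ s G X | eG | eX = refl

module _ (P : Game → Set) (step : ∀ X → (∀ s {x} → x ∈ opts s X → P x) → P X) where
  mutual
    game-ind : ∀ X → P X
    game-ind ⟨ l ∣ r ⟩ = step ⟨ l ∣ r ⟩ λ { left → members l ; right → members r }

    members : ∀ xs {x} → x ∈ xs → P x
    members (y ∷ _)  (here refl) = game-ind y
    members (_ ∷ ys) (there m)   = members ys m

deadEnding-opt : ∀ s {X x} → DeadEnding X → x ∈ opts s X → DeadEnding x
deadEnding-opt left  d m F f = d F (viaL m f)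
deadEnding-opt right d m F f = d F (viaR m f)

_≈ᵒ_ : Game → Game → Set
Y ≈ᵒ Z = (oL Y ≡ oL Z) × (oR Y ≡ oR Z)

≈ᵒ-sums⇒≡ℰ : ∀ G H → (∀ X → DeadEnding X → (G + X) ≈ᵒ (H + X)) → G ≡ℰ H
≈ᵒ-sums⇒≡ℰ G H same =
    (λ X d → ≡⇒≤ᴿ (sym (proj₁ (same X d))) , ≡⇒≤ᴿ (sym (proj₂ (same X d))))
  , (λ X d → ≡⇒≤ᴿ (proj₁ (same X d)) , ≡⇒≤ᴿ (proj₂ (same X d)))

oR-R-transfer : ∀ G H X → rightOpts G ≡ rightOpts H →
  (∀ {x} → x ∈ rightOpts X → oL (G + x) ≡ oL (H + x)) →
  oR (G + X) ≡ R → oR (H + X) ≡ R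
oR-R-transfer G H X same agree p with oR-R⁻ (G + X) p
... | inj₁ end = oR-end (H + X)
      (end-+⁺ right H X (trans (sym same) (proj₁ ends)) (proj₂ ends))
  where
  ends : RightEnd G × RightEnd X
  ends = end-+⁻ right G X end
... | inj₂ (_ , m , q) with move-+⁻ right G X m
...   | inj₁ (g , g∈ , refl) = oR-move (H + X) (move-+ˡ right H X (subst (g ∈_) same g∈)) q
...   | inj₂ (x , x∈ , refl) = oR-move (H + X) (move-+ʳ right H X x∈) (trans (sym (agree x∈)) q)

oR-+-cong : ∀ G H X → rightOpts G ≡ rightOpts H →
  (∀ {x} → x ∈ rightOpts X → oL (G + x) ≡ oL (H + x)) →
  oR (G + X) ≡ oR (H + X)
oR-+-cong G H X same agree =
  res-ext R _ _ (oR-R-transfer G H X same agree)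
                (oR-R-transfer H G X (sym same) (λ m → sym (agree m)))

module Reversal (G A E : Game) (A∈G : A ∈ leftOpts G) (E∈A : E ∈ rightOpts A)
                (E-end : LeftEnd E) (E≤G : E ≤ℰ G) where

  A′ H : Game
  A′ = ⟨ [] ∣ E ∷ [] ⟩
  H  = ⟨ A′ ∷ (leftOpts G ∖ A) ∣ rightOpts G ⟩

  -- The induction hypothesis needed for the Left outcome of G + X.
  AgreeOnLeftOpts : Game → Set
  AgreeOnLeftOpts X = ∀ {x} → x ∈ leftOpts X → oR (G + x) ≡ oR (H + x)

  -- If E + X is a Left win with Left to move, so is H + X: either E + X
  -- is a Left-end, then X is a dead Left-end and every Right move in A′ + X
  -- is a Left win, or Left wins by some E + x, and then H + x is at least
  -- as good for Left, since E ≤_𝓔 G.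
  E-win⇒H-win : ∀ X → DeadEnding X → AgreeOnLeftOpts X → oL (E + X) ≡ L → oL (H + X) ≡ L
  E-win⇒H-win X d agree p with oL-L⁻ (E + X) p
  ... | inj₁ end = oL-move (H + X) (move-+ˡ left H X (here refl))
                     (oR-L⁺ (A′ + X) (move-+ˡ right A′ X (here refl)) A′+X-wins)
    where
    X-dead : DeadLeftEnd X
    X-dead = proj₁ (d X self) (proj₂ (end-+⁻ left E X end))

    A′+X-wins : ∀ {Z} → Z ∈ rightOpts (A′ + X) → oL Z ≡ L
    A′+X-wins m with move-+⁻ right A′ X m
    ... | inj₁ (_ , here refl , refl) = p
    ... | inj₂ (x , x∈ , refl) =
          oL-end (A′ + x) (end-+⁺ left A′ x refl (X-dead x (viaR x∈ self)))
  ... | inj₂ (_ , m , q) with move-+⁻ left E X m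
  ...   | inj₁ (e , e∈ , _) = ⊥-elim (∉[] (subst (e ∈_) E-end e∈))
  ...   | inj₂ (x , x∈ , refl) =
          oL-move (H + X) (move-+ʳ left H X x∈)
            (trans (sym (agree x∈)) (L-upward q (proj₂ (E≤G x (deadEnding-opt left d x∈)))))

  -- A winning Left move in G + X yields one in H + X; the move to A + X
  -- is winning only if E + X is a Left win.
  G-win⇒H-win : ∀ X → DeadEnding X → AgreeOnLeftOpts X → oL (G + X) ≡ L → oL (H + X) ≡ L
  G-win⇒H-win X d agree p with oL-L⁻ (G + X) p
  ... | inj₁ end = ⊥-elim (∉[] (subst (A + X ∈_) end (move-+ˡ left G X A∈G)))
  ... | inj₂ (_ , m , q) with move-+⁻ left G X m
  ...   | inj₂ (x , x∈ , refl) = oL-move (H + X) (move-+ʳ left H X x∈) (trans (sym (agree x∈)) q)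
  ...   | inj₁ (g , g∈ , refl) with g ≟ A
  ...     | yes refl = E-win⇒H-win X d agree (oR-L-after (A + X) (move-+ˡ right A X E∈A) q)
  ...     | no g≢A = oL-move (H + X)
                       (move-+ˡ left H X (there (∈-filter⁺ (λ y → ¬? (y ≟ A)) g∈ g≢A))) q

  -- A winning Left move in H + X yields one in G + X; a winning move to
  -- A′ + X makes E + X, hence G + X, a Left win.
  H-win⇒G-win : ∀ X → DeadEnding X → AgreeOnLeftOpts X → oL (H + X) ≡ L → oL (G + X) ≡ L
  H-win⇒G-win X d agree p with oL-L⁻ (H + X) p
  ... | inj₁ end = ⊥-elim (∉[] (subst (A′ + X ∈_) end (move-+ˡ left H X (here refl))))
  ... | inj₂ (_ , m , q) with move-+⁻ left H X m
  ...   | inj₂ (x , x∈ , refl) = oL-move (G + X) (move-+ʳ left G X x∈) (trans (agree x∈) q)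
  ...   | inj₁ (_ , here refl , refl) =
          L-upward (oR-L-after (A′ + X) (move-+ˡ right A′ X (here refl)) q) (proj₁ (E≤G X d))
  ...   | inj₁ (g , there g∈ , refl) =
          oL-move (G + X) (move-+ˡ left G X (proj₁ (∈-filter⁻ (λ y → ¬? (y ≟ A)) g∈))) q

  same-outcomes : ∀ X → DeadEnding X → (G + X) ≈ᵒ (H + X)
  same-outcomes = game-ind (λ X → DeadEnding X → (G + X) ≈ᵒ (H + X)) step
    where
    step : ∀ X → (∀ s {x} → x ∈ opts s X → DeadEnding x → (G + x) ≈ᵒ (H + x)) →
           DeadEnding X → (G + X) ≈ᵒ (H + X)
    step X ih d =
        res-ext L _ _ (G-win⇒H-win X d agreeL) (H-win⇒G-win X d agreeL)
      , oR-+-cong G H X refl (λ m → proj₁ (ih right m (deadEnding-opt right d m)))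
      where
      agreeL : AgreeOnLeftOpts X
      agreeL m = proj₂ (ih left m (deadEnding-opt left d m))

-- Theorem: the reversal through the dead Left-end E preserves the
-- equivalence class modulo 𝓔.
mainTheorem9 : (G A E : Game) → DeadEnding G →
    A ∈ leftOpts G → E ∈ rightOpts A → LeftEnd E → E ≤ℰ G →
    G ≡ℰ ⟨ ⟨ [] ∣ E ∷ [] ⟩ ∷ (leftOpts G ∖ A) ∣ rightOpts G ⟩
mainTheorem9 G A E _ A∈G E∈A E-end E≤G =
  ≈ᵒ-sums⇒≡ℰ G H same-outcomes
  where open Reversal G A E A∈G E∈A E-end E≤G
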